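{- Let $C$ be a dendritic face complex with greatest element $\omega$, $n=\dim\omega$, and let $0\le k\le n$. If $d\in C_k$ is not a source (i.e. there is no $c\in C_{k+1}$ with $d\prec^-c$), then $d=\gamma^{(k)}\omega$.
   Context: A positive-to-one poset (POP) is a finite set $P$ with $\dim:P\to\mathbb{N}$ and binary relations $\prec^-,\prec^+$; $y\prec x$ means $y\prec^-x$ or $y\prec^+x$. Axioms: $y\prec x\Rightarrow\dim x=\dim y+1$; never both $y\prec^-x$ and $y\prec^+x$; every $x$ with $\dim x\ge1$ has exactly one $y$ with $y\prec^+x$, denoted $\gamma(x)$, and at least one $y$ with $y\prec^-x$. $\delta(x)=\{y:y\prec^-x\}$, $C_k=\dim^{ -1}(k)$; $\le$ is the reflexive-transitive closure of $\prec$. A dendritic face complex is a POP such that: it has a greatest element for $\le$; (oriented thinness) whenever $z\prec^{\beta}y\prec^{\alpha}x$ there is a unique $y'\ne y$ with $z\prec y'\prec x$, and writing $z\prec^{\beta'}y'\prec^{\alpha'}x$ the signs (as $\pm1$) satisfy $\alpha\beta=-\alpha'\beta'$; (acyclicity) $\delta(x)$ is a singleton if $\dim x=1$, nonempty if $\dim x\ge1$, and for $\dim x\ge1$ there are no $p\ge1$, $y_1,\dots,y_p\in\delta(x)$ with $\gamma(y_{i+1})\in\delta(y_i)$ ($1\le i<p$) and $\gamma(y_1)\in\delta(y_p)$. For $0\le k\le n$, $\gamma^{(k)}\omega:=\gamma^{n-k}(\omega)$, the iterated target of $\omega$ of dimension $k$. -}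

module Defs where

open import Data.Nat using (ℕ; zero; suc; _≥_)
open import Data.Fin using (Fin; zero; suc; inject₁; fromℕ)
open import Data.Sign using (Sign; opposite) renaming (_*_ to _·_)
open import Data.Product using (Σ; _×_; _,_; ∃; ∃-syntax)
open import Relation.Nullary using (¬_)
open import Relation.Binary.PropositionalEquality using (_≡_; _≢_)
open import Relation.Binary.Construct.Closure.ReflexiveTransitive using (Star)
open import Data.Empty using (⊥)

-- A positive-to-one poset on the finite carrier Fin N.
-- y ≺[ s ] x  means  y ≺^s x  (s ∈ {-,+}).
-- γ is the notation for the unique y with y ≺⁺ x (only meaningful when dim x ≥ 1);
-- the fields γ-spec / γ-unique state that such y exists and is unique.
record POP (N : ℕ) : Set₁ where
  field
    dim      : Fin N → ℕ
    _≺[_]_   : Fin N → Sign → Fin N → Set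
    dim-≺    : ∀ {y s x} → y ≺[ s ] x → dim x ≡ suc (dim y)
    not-both : ∀ {y x} → ¬ (y ≺[ Sign.- ] x × y ≺[ Sign.+ ] x)
    γ        : Fin N → Fin N
    γ-spec   : ∀ x → dim x ≥ 1 → γ x ≺[ Sign.+ ] x
    γ-unique : ∀ x → dim x ≥ 1 → ∀ y → y ≺[ Sign.+ ] x → y ≡ γ x
    δ-nonempty : ∀ x → dim x ≥ 1 → ∃[ y ] (y ≺[ Sign.- ] x)

  _≺_ : Fin N → Fin N → Set
  y ≺ x = Σ Sign λ s → y ≺[ s ] x

  _≤P_ : Fin N → Fin N → Set
  _≤P_ = Star _≺_

  γ^ : ℕ → Fin N → Fin N
  γ^ zero x = x
  γ^ (suc m) x = γ (γ^ m x)

record DendriticFaceComplex (N : ℕ) : Set₁ where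
  field
    pop : POP N
  open POP pop public
  field
    greatest : ∃[ ω ] (∀ x → x ≤P ω)
    thin : ∀ {z y x α β} → z ≺[ β ] y → y ≺[ α ] x →
      Σ (Fin N) λ y' → y' ≢ y ×
        (Σ Sign λ α' → Σ Sign λ β' → z ≺[ β' ] y' × y' ≺[ α' ] x ×
             (α · β) ≡ opposite (α' · β')) ×
        (∀ y'' → y'' ≢ y → z ≺ y'' → y'' ≺ x → y'' ≡ y')
    δ-singleton : ∀ x → dim x ≡ 1 → ∃[ y ] (y ≺[ Sign.- ] x × (∀ y' → y' ≺[ Sign.- ] x → y' ≡ y))
    acyclic : ∀ x → dim x ≥ 1 → ∀ (p : ℕ) (ys : Fin (suc p) → Fin N) →
      (∀ i → ys i ≺[ Sign.- ] x) →
      (∀ (i : Fin p) → γ (ys (suc i)) ≺[ Sign.- ] ys (inject₁ i)) →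
      γ (ys zero) ≺[ Sign.- ] ys (fromℕ p) → ⊥

{-# OPTIONS --safe #-}
-- Since a non-source d lies below ω, it suffices to show that d ≤ x with dim x > dim d
-- forces d ≤ γ x; iterating this down to dimension dim d pins d to γ^(dim ω − dim d) ω.
-- The last step of a chain d ≤ ⋯ ≺ x is either γ x itself, or an input face y of x
-- (which cannot be d, as d is not a source). In the latter case thinness at γ y ≺⁺ y ≺⁻ x
-- shows that γ y is an output face of γ x or an input face of another y′ ∈ δ(x), so
-- d ≤ γ y′ by induction on dimension. Repeating, we walk along δ(x); acyclicity and
-- finiteness force the walk to exit through γ x.
module Submission where

open import Defs
open import Data.Nat using (ℕ; suc; _≤_; _∸_)
open import Data.Fin using (Fin)
open import Data.Sign using (Sign)
open import Data.Product using (∃-syntax; _×_)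
open import Relation.Nullary using (¬_)
open import Relation.Binary.PropositionalEquality using (_≡_)

open import Data.Nat using (zero; _+_; _<_; z≤n; s≤s)
open import Data.Nat.Properties
open import Data.Fin using (toℕ; inject₁; fromℕ)
open import Data.Fin.Properties using (pigeonhole; toℕ-inject₁; toℕ-fromℕ; toℕ<n; toℕ≤pred[n])
open import Data.Product using (_,_; ∃₂)
open import Data.Sum using (_⊎_; inj₁; inj₂)
open import Data.Empty using (⊥-elim)
open import Relation.Nullary using (yes; no)
open import Relation.Binary.Core using (Rel)
open import Relation.Binary.PropositionalEquality using (_≢_; refl; sym; trans; cong; subst)
open import Relation.Binary.Construct.Closure.ReflexiveTransitive using (Star; ε; _◅_; _◅◅_)

Star-unsnoc : ∀ {a ℓ} {A : Set a} {T : Rel A ℓ} {x z} → Star T x z →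
              x ≡ z ⊎ ∃[ y ] (Star T x y × T y z)
Star-unsnoc ε = inj₁ refl
Star-unsnoc (t ◅ ts) with Star-unsnoc ts
... | inj₁ refl = inj₂ (_ , ε , t)
... | inj₂ (y , ts′ , t′) = inj₂ (y , t ◅ ts′ , t′)

repetition : ∀ {N} (b : ℕ → Fin N) → ∃₂ λ i p → suc p + i ≤ N × b i ≡ b (suc p + i)
repetition {N} b with pigeonhole ≤-refl (λ t → b (toℕ {suc N} t))
... | t₁ , t₂ , t₁<t₂ , bt₁≡bt₂ =
  toℕ t₁ , p , subst (_≤ N) (sym gap) (toℕ≤pred[n] t₂) , trans bt₁≡bt₂ (cong b (sym gap))
  where
    p : ℕ
    p = toℕ t₂ ∸ suc (toℕ t₁)
    gap : suc p + toℕ t₁ ≡ toℕ t₂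
    gap = trans (sym (+-suc p (toℕ t₁))) (m∸n+n≡m t₁<t₂)

_◂_ : ∀ {a} {A : Set a} → A → (ℕ → A) → ℕ → A
(x ◂ b) zero = x
(x ◂ b) (suc i) = b i

module POPProperties {N : ℕ} (P : POP N) where
  open POP P

  dim-< : ∀ {y s x} → y ≺[ s ] x → dim y < dim x
  dim-< y≺x = ≤-reflexive (sym (dim-≺ y≺x))

  dim-≺⁻¹ : ∀ {y s x m} → y ≺[ s ] x → dim x ≡ suc m → dim y ≡ m
  dim-≺⁻¹ y≺x dx = suc-injective (trans (sym (dim-≺ y≺x)) dx)

  dim-γ : ∀ {x m} → dim x ≡ suc m → dim (γ x) ≡ m
  dim-γ {x} dx = dim-≺⁻¹ (γ-spec x (subst (1 ≤_) (sym dx) (s≤s z≤n))) dx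

  ≺⁺⇒≡γ : ∀ {y x} → y ≺[ Sign.+ ] x → y ≡ γ x
  ≺⁺⇒≡γ {y} {x} y≺x = γ-unique x (subst (1 ≤_) (sym (dim-≺ y≺x)) (s≤s z≤n)) y y≺x

  ≤P⇒dim≤ : ∀ {y x} → y ≤P x → dim y ≤ dim x
  ≤P⇒dim≤ ε = ≤-refl
  ≤P⇒dim≤ ((_ , y≺z) ◅ z≤x) = ≤-trans (<⇒≤ (dim-< y≺z)) (≤P⇒dim≤ z≤x)

  ≤P-dim≡⇒≡ : ∀ {y x} → y ≤P x → dim y ≡ dim x → y ≡ x
  ≤P-dim≡⇒≡ ε _ = refl
  ≤P-dim≡⇒≡ ((_ , y≺z) ◅ z≤x) dy≡dx = ⊥-elim (<-irrefl dy≡dx (<-≤-trans (dim-< y≺z) (≤P⇒dim≤ z≤x)))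

  γ^-γ : ∀ j x → γ^ j (γ x) ≡ γ^ (suc j) x
  γ^-γ zero x = refl
  γ^-γ (suc j) x = cong γ (γ^-γ j x)

  UpwardClosed : (Fin N → Set) → Set
  UpwardClosed Q = ∀ {z w} → z ≺ w → Q z → Q w

  ≤P-upwardClosed : ∀ y → UpwardClosed (y ≤P_)
  ≤P-upwardClosed y z≺w y≤z = y≤z ◅◅ (z≺w ◅ ε)

  IsSource : Fin N → Set
  IsSource d = ∃[ c ] d ≺[ Sign.- ] c

module DendriticProperties {N : ℕ} (C : DendriticFaceComplex N) where
  open DendriticFaceComplex C
  open POPProperties pop public

  input-target-dichotomy : ∀ {y x} → y ≺[ Sign.- ] x → 1 ≤ dim y →
                           γ y ≺[ Sign.+ ] γ x ⊎ ∃[ y′ ] (y′ ≺[ Sign.- ] x × γ y ≺[ Sign.- ] y′)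
  input-target-dichotomy {y} y≺x y≥1 with thin (γ-spec y y≥1) y≺x
  ... | y′ , _ , (Sign.+ , Sign.+ , γy≺y′ , y′≺x , _) , _ = inj₁ (subst (γ y ≺[ Sign.+ ]_) (≺⁺⇒≡γ y′≺x) γy≺y′)
  ... | y′ , _ , (Sign.- , Sign.- , γy≺y′ , y′≺x , _) , _ = inj₂ (y′ , y′≺x , γy≺y′)
  ... | _ , _ , (Sign.+ , Sign.- , _ , _ , ()) , _
  ... | _ , _ , (Sign.- , Sign.+ , _ , _ , ()) , _

  -- Open versions of the cycles forbidden by `acyclic`.
  InputChain : Fin N → ℕ → (ℕ → Fin N) → Set
  InputChain x n b = (∀ i → i ≤ n → b i ≺[ Sign.- ] x) × (∀ i → i < n → γ (b (suc i)) ≺[ Sign.- ] b i)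

  InputChain-◂ : ∀ {x n b y} → y ≺[ Sign.- ] x → γ (b 0) ≺[ Sign.- ] y →
                 InputChain x n b → InputChain x (suc n) (y ◂ b)
  InputChain-◂ {x} {n} {b} {y} y≺x γb₀≺y (inputs , links) = inputs′ , links′
    where
      inputs′ : ∀ i → i ≤ suc n → (y ◂ b) i ≺[ Sign.- ] x
      inputs′ zero _ = y≺x
      inputs′ (suc i) (s≤s i≤n) = inputs i i≤n
      links′ : ∀ i → i < suc n → γ ((y ◂ b) (suc i)) ≺[ Sign.- ] (y ◂ b) i
      links′ zero _ = γb₀≺y
      links′ (suc i) (s≤s i<n) = links i i<n

  InputChain-drop : ∀ {x n b} i {m} → m + i ≤ n → InputChain x n b → InputChain x m (λ t → b (t + i))
  InputChain-drop i m+i≤n (inputs , links) =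
    (λ t t≤m → inputs (t + i) (≤-trans (+-monoˡ-≤ i t≤m) m+i≤n)) ,
    (λ t t<m → links (t + i) (≤-trans (+-monoˡ-≤ i t<m) m+i≤n))

  InputChain-unclosed : ∀ {x p b} → 1 ≤ dim x → InputChain x (suc p) b → b 0 ≢ b (suc p)
  InputChain-unclosed {x} {p} {b} x≥1 (inputs , links) b₀≡bₚ₊₁ =
    acyclic x x≥1 p (λ t → b (toℕ t)) inputs′ links′ closing
    where
      inputs′ : ∀ t → b (toℕ t) ≺[ Sign.- ] x
      inputs′ t = inputs (toℕ t) (m≤n⇒m≤1+n (toℕ≤pred[n] t))
      links′ : ∀ (t : Fin p) → γ (b (suc (toℕ t))) ≺[ Sign.- ] b (toℕ (inject₁ t))
      links′ t rewrite toℕ-inject₁ t = links (toℕ t) (m<n⇒m<1+n (toℕ<n t))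
      closing : γ (b 0) ≺[ Sign.- ] b (toℕ (fromℕ p))
      closing rewrite toℕ-fromℕ p | b₀≡bₚ₊₁ = links p ≤-refl

  InputChain-bounded : ∀ {x n b} → 1 ≤ dim x → InputChain x n b → n < N
  InputChain-bounded {n = n} {b} x≥1 chain with n <? N
  ... | yes n<N = n<N
  ... | no n≮N with repetition b
  ...   | i , p , p+1+i≤N , bᵢ≡bₚ₊₁₊ᵢ =
    ⊥-elim (InputChain-unclosed x≥1 (InputChain-drop i (≤-trans p+1+i≤N (≮⇒≥ n≮N)) chain) bᵢ≡bₚ₊₁₊ᵢ)

  module _ {Q : Fin N → Set} (upward : UpwardClosed Q) {x} (x≥2 : 2 ≤ dim x)
           (input-γ : ∀ {y} → y ≺[ Sign.- ] x → Q y → Q (γ y)) where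

    private
      x≥1 : 1 ≤ dim x
      x≥1 = ≤-trans (s≤s z≤n) x≥2

      input-dim≥1 : ∀ {y} → y ≺[ Sign.- ] x → 1 ≤ dim y
      input-dim≥1 y≺x = ≤-pred (subst (2 ≤_) (dim-≺ y≺x) x≥2)

      -- Fuel f: by InputChain-bounded the chain never reaches length N.
      walk : ∀ f n b → n + f ≡ N → InputChain x n b → Q (b 0) → Q (γ x)
      walk zero n b n+0≡N chain _ =
        ⊥-elim (<-irrefl (trans (sym (+-identityʳ n)) n+0≡N) (InputChain-bounded x≥1 chain))
      walk (suc f) n b n+f+1≡N chain@(inputs , _) Qb₀
        with input-target-dichotomy (inputs 0 z≤n) (input-dim≥1 (inputs 0 z≤n))
      ... | inj₁ γb₀≺γx = upward (Sign.+ , γb₀≺γx) (input-γ (inputs 0 z≤n) Qb₀)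
      ... | inj₂ (y , y≺x , γb₀≺y) =
        walk f (suc n) (y ◂ b) (trans (sym (+-suc n f)) n+f+1≡N)
             (InputChain-◂ y≺x γb₀≺y chain) (upward (Sign.- , γb₀≺y) (input-γ (inputs 0 z≤n) Qb₀))

    propagate-to-target : ∀ {y} → y ≺[ Sign.- ] x → Q y → Q (γ x)
    propagate-to-target y≺x Qy = walk N 0 (λ _ → _) refl ((λ _ _ → y≺x) , λ _ ()) Qy

  nonsource-below⇒below-γ : ∀ {d} → ¬ IsSource d → ∀ m {x} →
                            dim x ≡ suc m + dim d → d ≤P x → d ≤P γ x
  nonsource-below⇒below-γ {d} nonsource m {x} dx d≤x with Star-unsnoc d≤x
  ... | inj₁ refl = ⊥-elim (m≢1+n+m (dim d) dx)
  ... | inj₂ (y , d≤y , Sign.+ , y≺x) = subst (d ≤P_) (≺⁺⇒≡γ y≺x) d≤y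
  ... | inj₂ (y , d≤y , Sign.- , y≺x) with m
  ...   | zero = ⊥-elim (nonsource (x , subst (_≺[ Sign.- ] x) y≡d y≺x))
    where
      y≡d : y ≡ d
      y≡d = sym (≤P-dim≡⇒≡ d≤y (sym (dim-≺⁻¹ y≺x dx)))
  ...   | suc m′ =
    propagate-to-target (≤P-upwardClosed d) (subst (2 ≤_) (sym dx) (s≤s (s≤s z≤n)))
      (λ y′≺x → nonsource-below⇒below-γ nonsource m′ (dim-≺⁻¹ y′≺x dx)) y≺x d≤y

  nonsource-below⇒≡γ^ : ∀ {d} → ¬ IsSource d → ∀ j {x} → dim x ≡ j + dim d → d ≤P x → d ≡ γ^ j x
  nonsource-below⇒≡γ^ nonsource zero dx d≤x = ≤P-dim≡⇒≡ d≤x (sym dx)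
  nonsource-below⇒≡γ^ nonsource (suc j) {x} dx d≤x =
    trans (nonsource-below⇒≡γ^ nonsource j (dim-γ dx) (nonsource-below⇒below-γ nonsource j dx d≤x))
          (γ^-γ j x)

mainTheorem15 : ∀ {N : ℕ} (C : DendriticFaceComplex N) → let open DendriticFaceComplex C in
    ∀ (ω : Fin N) → (∀ x → x ≤P ω) → ∀ (k : ℕ) → k ≤ dim ω →
    ∀ (d : Fin N) → dim d ≡ k → ¬ (∃[ c ] (dim c ≡ suc k × d ≺[ Sign.- ] c)) →
    d ≡ γ^ (dim ω ∸ k) ω
mainTheorem15 C ω below-ω k k≤n d refl nonsource =
  nonsource-below⇒≡γ^ (λ (c , d≺c) → nonsource (c , dim-≺ d≺c , d≺c))
    (dim ω ∸ dim d) (sym (m∸n+n≡m k≤n)) (below-ω d)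
  where
    open DendriticFaceComplex C
    open DendriticProperties C
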